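{- Let $H\in\operatorname{BH}(4m^2,4)$ be of Bush-type. Then there are at least $2^{2m}$ self-dual $H$-bent vectors, and at least $2^{2m}$ conjugate self-dual $(-H)$-bent vectors.
   Context: $\langle\zeta_k\rangle$ is the set of $k$-th roots of unity ($\langle\zeta_4\rangle=\{\pm1,\pm i\}$). $\operatorname{BH}(N,k)$ is the set of $N\times N$ matrices $H$ with entries in $\langle\zeta_k\rangle$ and $HH^*=NI_N$. A matrix $H\in\operatorname{BH}(s^2,k)$ is of Bush-type if it can be partitioned into $s\times s$ blocks $H_{ij}$, $1\le i,j\le s$, with $JH_{ij}=H_{ij}J=\delta_{i,j}\,sJ$, where $J$ is the $s\times s$ all-ones matrix. For $H\in\operatorname{BH}(N,k)$, a vector $\mathbf{x}\in\langle\zeta_k\rangle^N$ is self-dual $H$-bent if $H\mathbf{x}=\sqrt N\lambda\mathbf{x}$, and conjugate self-dual $H$-bent if $H\mathbf{x}=\sqrt N\lambda\overline{\mathbf{x}}$, for some complex $\lambda$ with $|\lambda|=1$. -}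

module Defs where

open import Data.Nat using (ℕ; zero; suc; _^_) renaming (_*_ to _*ℕ_)
open import Data.Integer using (ℤ; +_; -_) renaming (_+_ to _+ℤ_; _*_ to _*ℤ_; _-_ to _-ℤ_)
open import Data.Fin using (Fin; zero; suc; combine)
open import Data.Product using (Σ; _×_; _,_)
open import Relation.Binary.PropositionalEquality using (_≡_; _≢_)
open import Relation.Nullary using (¬_)

-- Gaussian integers ℤ[i] (all matrix/vector arithmetic here lives in ℤ[i] ⊂ ℂ)
record ℤ[i] : Set where
  constructor _+i_
  field
    re : ℤ
    im : ℤ
open ℤ[i] public

0G : ℤ[i]
0G = (+ 0) +i (+ 0)

_+G_ : ℤ[i] → ℤ[i] → ℤ[i]
(a +i b) +G (c +i d) = (a +ℤ c) +i (b +ℤ d)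

_*G_ : ℤ[i] → ℤ[i] → ℤ[i]
(a +i b) *G (c +i d) = ((a *ℤ c) -ℤ (b *ℤ d)) +i ((a *ℤ d) +ℤ (b *ℤ c))

conjG : ℤ[i] → ℤ[i]
conjG (a +i b) = a +i (- b)

normG : ℤ[i] → ℤ
normG (a +i b) = (a *ℤ a) +ℤ (b *ℤ b)

natG : ℕ → ℤ[i]
natG n = (+ n) +i (+ 0)

sumG : ∀ {n} → (Fin n → ℤ[i]) → ℤ[i]
sumG {zero}  f = 0G
sumG {suc n} f = f zero +G sumG (λ k → f (suc k))

data μ₄ : Set where
  one i′ mone mi : μ₄

toG : μ₄ → ℤ[i]
toG one  = (+ 1) +i (+ 0)
toG i′   = (+ 0) +i (+ 1)
toG mone = (- (+ 1)) +i (+ 0)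
toG mi   = (+ 0) +i (- (+ 1))

negμ : μ₄ → μ₄
negμ one  = mone
negμ i′   = mi
negμ mone = one
negμ mi   = i′

conjμ : μ₄ → μ₄
conjμ one  = one
conjμ i′   = mi
conjμ mone = mone
conjμ mi   = i′

Matrix : ℕ → Set
Matrix N = Fin N → Fin N → μ₄

Vector : ℕ → Set
Vector N = Fin N → μ₄

kron : ∀ {N} → Fin N → Fin N → ℤ[i]
kron zero    zero    = natG 1
kron zero    (suc _) = 0G
kron (suc _) zero    = 0G
kron (suc a) (suc b) = kron a b

negM : ∀ {N} → Matrix N → Matrix N
negM H a b = negμ (H a b)

IsBH : (N : ℕ) → Matrix N → Set
IsBH N H = ∀ a b →
  sumG (λ k → toG (H a k) *G conjG (toG (H b k))) ≡ natG N *G kron a b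

-- Bush-type for H ∈ BH(s², 4): blocks H_{ij}(a,b) = H (combine i a) (combine j b);
-- J H_{ij} = H_{ij} J = δ_{ij} s J  (column sums and row sums of each block)
IsBushType : (s : ℕ) → Matrix (s *ℕ s) → Set
IsBushType s H =
  (∀ (i j a : Fin s) → sumG (λ (b : Fin s) → toG (H (combine i a) (combine j b))) ≡ natG s *G kron i j) ×
  (∀ (i j b : Fin s) → sumG (λ (a : Fin s) → toG (H (combine i a) (combine j b))) ≡ natG s *G kron i j)

applyM : ∀ {N} → Matrix N → Vector N → Fin N → ℤ[i]
applyM H x a = sumG (λ k → toG (H a k) *G toG (x k))

-- self-dual H-bent: H x = √N λ x with |λ| = 1; here √N = r and we write μ = r λ,
-- which lies in ℤ[i] necessarily (μ = (Hx)_a · conj(x_a)), with |μ|² = r².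
IsSelfDualBent : ∀ {N} (r : ℕ) → Matrix N → Vector N → Set
IsSelfDualBent {N} r H x = Σ ℤ[i] λ μ →
  (normG μ ≡ + (r *ℕ r)) × (∀ a → applyM H x a ≡ μ *G toG (x a))

IsConjSelfDualBent : ∀ {N} (r : ℕ) → Matrix N → Vector N → Set
IsConjSelfDualBent {N} r H x = Σ ℤ[i] λ μ →
  (normG μ ≡ + (r *ℕ r)) × (∀ a → applyM H x a ≡ μ *G toG (conjμ (x a)))

-- "at least K vectors with property P": an injective family of K such vectors
AtLeast : ∀ {N} → ℕ → (Vector N → Set) → Set
AtLeast {N} K P = Σ (Fin K → Vector N) λ f →
  (∀ k → P (f k)) × (∀ k l → k ≢ l → ¬ (∀ a → f k a ≡ f l a))

{-# OPTIONS --safe #-}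
-- For a Bush-type matrix every s × s block H_ij has constant row sums s δ_ij.  Hence a
-- vector which is constant, with value v_j, on the j-th block of coordinates satisfies
-- (H x)_(i,a) = Σ_j (row sum of H_ij) v_j = s v_i, i.e. H x = s x.  The 2^s choices of
-- signs v_j ∈ {±1} give distinct self-dual H-bent vectors, and since they are real they
-- are also conjugate self-dual (−H)-bent, with eigenvalue −s.
module Submission where

open import Defs
open import Data.Nat using (ℕ; _*_; _^_; zero; suc)
import Data.Nat as ℕ
open import Data.Integer using (+_)
import Data.Integer as ℤ
import Data.Integer.Properties as ℤ
open import Data.Integer.Tactic.RingSolver using (solve-∀)
open import Data.Fin using (Fin; zero; suc; combine; quotient; remQuot; finToFun; funToFin; _↑ˡ_; _↑ʳ_)
open import Data.Fin.Properties using (remQuot-combine; combine-remQuot; funToFin-finToFin)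
open import Data.Product using (_×_; _,_; proj₁; uncurry)
open import Function using (_∘_)
open import Relation.Binary.PropositionalEquality
open ≡-Reasoning

+G-assoc : ∀ x y z → (x +G y) +G z ≡ x +G (y +G z)
+G-assoc x y z = cong₂ _+i_ (ℤ.+-assoc (re x) (re y) (re z)) (ℤ.+-assoc (im x) (im y) (im z))

+G-identityˡ : ∀ x → 0G +G x ≡ x
+G-identityˡ x = cong₂ _+i_ (ℤ.+-identityˡ (re x)) (ℤ.+-identityˡ (im x))

+G-identityʳ : ∀ x → x +G 0G ≡ x
+G-identityʳ x = cong₂ _+i_ (ℤ.+-identityʳ (re x)) (ℤ.+-identityʳ (im x))

*G-comm : ∀ x y → x *G y ≡ y *G x
*G-comm (a +i b) (c +i d) = cong₂ _+i_ (reₚ a b c d) (imₚ a b c d)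
  where
  reₚ : ∀ a b c d → a ℤ.* c ℤ.- b ℤ.* d ≡ c ℤ.* a ℤ.- d ℤ.* b
  reₚ = solve-∀
  imₚ : ∀ a b c d → a ℤ.* d ℤ.+ b ℤ.* c ≡ c ℤ.* b ℤ.+ d ℤ.* a
  imₚ = solve-∀

*G-assoc : ∀ x y z → (x *G y) *G z ≡ x *G (y *G z)
*G-assoc (a +i b) (c +i d) (e +i f) = cong₂ _+i_ (reₚ a b c d e f) (imₚ a b c d e f)
  where
  reₚ : ∀ a b c d e f → (a ℤ.* c ℤ.- b ℤ.* d) ℤ.* e ℤ.- (a ℤ.* d ℤ.+ b ℤ.* c) ℤ.* f
                      ≡ a ℤ.* (c ℤ.* e ℤ.- d ℤ.* f) ℤ.- b ℤ.* (c ℤ.* f ℤ.+ d ℤ.* e)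
  reₚ = solve-∀
  imₚ : ∀ a b c d e f → (a ℤ.* c ℤ.- b ℤ.* d) ℤ.* f ℤ.+ (a ℤ.* d ℤ.+ b ℤ.* c) ℤ.* e
                      ≡ a ℤ.* (c ℤ.* f ℤ.+ d ℤ.* e) ℤ.+ b ℤ.* (c ℤ.* e ℤ.- d ℤ.* f)
  imₚ = solve-∀

*G-distribʳ-+G : ∀ x y z → (x +G y) *G z ≡ (x *G z) +G (y *G z)
*G-distribʳ-+G (a +i b) (c +i d) (e +i f) = cong₂ _+i_ (reₚ a b c d e f) (imₚ a b c d e f)
  where
  reₚ : ∀ a b c d e f → (a ℤ.+ c) ℤ.* e ℤ.- (b ℤ.+ d) ℤ.* f
                      ≡ (a ℤ.* e ℤ.- b ℤ.* f) ℤ.+ (c ℤ.* e ℤ.- d ℤ.* f)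
  reₚ = solve-∀
  imₚ : ∀ a b c d e f → (a ℤ.+ c) ℤ.* f ℤ.+ (b ℤ.+ d) ℤ.* e
                      ≡ (a ℤ.* f ℤ.+ b ℤ.* e) ℤ.+ (c ℤ.* f ℤ.+ d ℤ.* e)
  imₚ = solve-∀

*G-zeroˡ : ∀ x → 0G *G x ≡ 0G
*G-zeroˡ (a +i b) = cong₂ _+i_ (reₚ a b) (imₚ a b)
  where
  reₚ : ∀ a b → + 0 ℤ.* a ℤ.- + 0 ℤ.* b ≡ + 0
  reₚ = solve-∀
  imₚ : ∀ a b → + 0 ℤ.* b ℤ.+ + 0 ℤ.* a ≡ + 0
  imₚ = solve-∀

*G-identityˡ : ∀ x → natG 1 *G x ≡ x
*G-identityˡ (a +i b) = cong₂ _+i_ (reₚ a b) (imₚ a b)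
  where
  reₚ : ∀ a b → + 1 ℤ.* a ℤ.- + 0 ℤ.* b ≡ a
  reₚ = solve-∀
  imₚ : ∀ a b → + 1 ℤ.* b ℤ.+ + 0 ℤ.* a ≡ b
  imₚ = solve-∀

normG-*G : ∀ x y → normG (x *G y) ≡ normG x ℤ.* normG y
normG-*G (a +i b) (c +i d) = normₚ a b c d
  where
  normₚ : ∀ a b c d → (a ℤ.* c ℤ.- b ℤ.* d) ℤ.* (a ℤ.* c ℤ.- b ℤ.* d) ℤ.+ (a ℤ.* d ℤ.+ b ℤ.* c) ℤ.* (a ℤ.* d ℤ.+ b ℤ.* c)
                    ≡ (a ℤ.* a ℤ.+ b ℤ.* b) ℤ.* (c ℤ.* c ℤ.+ d ℤ.* d)
  normₚ = solve-∀

normG-natG : ∀ n → normG (natG n) ≡ + (n * n)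
normG-natG n = begin
  + n ℤ.* + n ℤ.+ + 0  ≡⟨ ℤ.+-identityʳ (+ n ℤ.* + n) ⟩
  + n ℤ.* + n          ≡⟨ ℤ.pos-* n n ⟨
  + (n * n)            ∎

-1G : ℤ[i]
-1G = toG mone

toG-negμ : ∀ z → toG (negμ z) ≡ -1G *G toG z
toG-negμ one  = refl
toG-negμ i′   = refl
toG-negμ mone = refl
toG-negμ mi   = refl

sumG-cong : ∀ {n} {f g : Fin n → ℤ[i]} → (∀ k → f k ≡ g k) → sumG f ≡ sumG g
sumG-cong {zero}  f≗g = refl
sumG-cong {suc n} f≗g = cong₂ _+G_ (f≗g zero) (sumG-cong (f≗g ∘ suc))

sumG-zero : ∀ n → sumG {n} (λ _ → 0G) ≡ 0G
sumG-zero zero    = refl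
sumG-zero (suc n) = trans (+G-identityˡ _) (sumG-zero n)

sumG-splitAt : ∀ m n (f : Fin (m ℕ.+ n) → ℤ[i]) →
  sumG f ≡ sumG (λ i → f (i ↑ˡ n)) +G sumG (λ j → f (m ↑ʳ j))
sumG-splitAt zero    n f = sym (+G-identityˡ _)
sumG-splitAt (suc m) n f = trans (cong (f zero +G_) (sumG-splitAt m n (f ∘ suc)))
                                 (sym (+G-assoc (f zero) _ _))

sumG-combine : ∀ m n (f : Fin (m * n) → ℤ[i]) →
  sumG f ≡ sumG (λ (i : Fin m) → sumG (λ (j : Fin n) → f (combine i j)))
sumG-combine zero    n f = refl
sumG-combine (suc m) n f = trans (sumG-splitAt n (m * n) f)
                                 (cong (sumG (λ j → f (j ↑ˡ (m * n))) +G_) (sumG-combine m n (f ∘ (n ↑ʳ_))))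

sumG-*ʳ : ∀ {n} (f : Fin n → ℤ[i]) c → sumG (λ k → f k *G c) ≡ sumG f *G c
sumG-*ʳ {zero}  f c = sym (*G-zeroˡ c)
sumG-*ʳ {suc n} f c = trans (cong ((f zero *G c) +G_) (sumG-*ʳ (f ∘ suc) c))
                            (sym (*G-distribʳ-+G (f zero) (sumG (f ∘ suc)) c))

sumG-*ˡ : ∀ {n} (f : Fin n → ℤ[i]) c → sumG (λ k → c *G f k) ≡ c *G sumG f
sumG-*ˡ f c = trans (sumG-cong (λ k → *G-comm c (f k)))
                    (trans (sumG-*ʳ f c) (*G-comm (sumG f) c))

sumG-kron : ∀ {n} (i : Fin n) (f : Fin n → ℤ[i]) → sumG (λ j → kron i j *G f j) ≡ f i
sumG-kron {suc n} zero f = begin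
  (natG 1 *G f zero) +G sumG (λ j → 0G *G f (suc j))  ≡⟨ cong₂ _+G_ (*G-identityˡ (f zero)) (sumG-cong (*G-zeroˡ ∘ f ∘ suc)) ⟩
  f zero +G sumG {n} (λ _ → 0G)                       ≡⟨ cong (f zero +G_) (sumG-zero n) ⟩
  f zero +G 0G                                        ≡⟨ +G-identityʳ (f zero) ⟩
  f zero                                              ∎
sumG-kron {suc n} (suc i) f = trans (cong₂ _+G_ (*G-zeroˡ (f zero)) (sumG-kron i (f ∘ suc)))
                                    (+G-identityˡ (f (suc i)))

BlockRowSums : (s : ℕ) → Matrix (s * s) → ℤ[i] → Set
BlockRowSums s M c =
  ∀ (i j a : Fin s) → sumG (λ (b : Fin s) → toG (M (combine i a) (combine j b))) ≡ c *G kron i j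

negM-blockRowSums : ∀ {s} M c → BlockRowSums s M c → BlockRowSums s (negM M) (-1G *G c)
negM-blockRowSums {s} M c rowSums i j a = begin
  sumG (λ b → toG (negμ (M (combine i a) (combine j b))))    ≡⟨ sumG-cong (λ b → toG-negμ (M (combine i a) (combine j b))) ⟩
  sumG (λ b → -1G *G toG (M (combine i a) (combine j b)))    ≡⟨ sumG-*ˡ _ -1G ⟩
  -1G *G sumG (λ b → toG (M (combine i a) (combine j b)))    ≡⟨ cong (-1G *G_) (rowSums i j a) ⟩
  -1G *G (c *G kron i j)                                     ≡⟨ *G-assoc -1G c (kron i j) ⟨
  (-1G *G c) *G kron i j                                     ∎

blockConst : (s : ℕ) → (Fin s → μ₄) → Vector (s * s)
blockConst s v a = v (quotient {s} s a)

blockConst-combine : ∀ s v (i a : Fin s) → blockConst s v (combine i a) ≡ v i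
blockConst-combine s v i a = cong (v ∘ proj₁) (remQuot-combine i a)

blockConst-injective : ∀ s {v w} → (∀ a → blockConst s v a ≡ blockConst s w a) → ∀ i → v i ≡ w i
blockConst-injective s {v} {w} v≡w i = begin
  v i                            ≡⟨ blockConst-combine s v i i ⟨
  blockConst s v (combine i i)   ≡⟨ v≡w (combine i i) ⟩
  blockConst s w (combine i i)   ≡⟨ blockConst-combine s w i i ⟩
  w i                            ∎

applyM-blockConst : ∀ {s} M c → BlockRowSums s M c →
  ∀ v a → applyM M (blockConst s v) a ≡ c *G toG (blockConst s v a)
applyM-blockConst {s} M c rowSums v a =
  subst (λ a → applyM M x a ≡ c *G toG (x a)) (combine-remQuot {s} s a) (uncurry eigen (remQuot {s} s a))
  where
  x : Vector (s * s)
  x = blockConst s v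
  eigen : ∀ i a → applyM M x (combine i a) ≡ c *G toG (x (combine i a))
  eigen i a = begin
    sumG (λ q → toG (M (combine i a) q) *G toG (x q))
      ≡⟨ sumG-combine s s _ ⟩
    sumG (λ j → sumG (λ b → toG (M (combine i a) (combine j b)) *G toG (x (combine j b))))
      ≡⟨ sumG-cong (λ j → sumG-cong (λ b → cong (λ z → toG (M (combine i a) (combine j b)) *G toG z) (blockConst-combine s v j b))) ⟩
    sumG (λ j → sumG (λ b → toG (M (combine i a) (combine j b)) *G toG (v j)))
      ≡⟨ sumG-cong (λ j → trans (sumG-*ʳ _ _) (cong (_*G toG (v j)) (rowSums i j a))) ⟩
    sumG (λ j → (c *G kron i j) *G toG (v j))
      ≡⟨ sumG-cong (λ j → trans (cong (_*G toG (v j)) (*G-comm c (kron i j))) (*G-assoc (kron i j) c _)) ⟩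
    sumG (λ j → kron i j *G (c *G toG (v j)))
      ≡⟨ sumG-kron i _ ⟩
    c *G toG (v i)
      ≡⟨ cong (λ z → c *G toG z) (blockConst-combine s v i a) ⟨
    c *G toG (x (combine i a)) ∎

blockConst-selfDualBent : ∀ {s} r M c → BlockRowSums s M c → normG c ≡ + (r * r) →
  ∀ v → IsSelfDualBent r M (blockConst s v)
blockConst-selfDualBent r M c rowSums ∣c∣² v = c , ∣c∣² , applyM-blockConst M c rowSums v

selfDualBent⇒conjSelfDualBent : ∀ {N r M} {x : Vector N} → (∀ a → conjμ (x a) ≡ x a) →
  IsSelfDualBent r M x → IsConjSelfDualBent r M x
selfDualBent⇒conjSelfDualBent real (μ , ∣μ∣² , Mx≡μx) =
  μ , ∣μ∣² , λ a → trans (Mx≡μx a) (cong (λ z → μ *G toG z) (sym (real a)))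

sign : Fin 2 → μ₄
sign zero    = one
sign (suc _) = mone

sign-injective : ∀ {e f} → sign e ≡ sign f → e ≡ f
sign-injective {zero}     {zero}     _ = refl
sign-injective {suc zero} {suc zero} _ = refl

conjμ-sign : ∀ e → conjμ (sign e) ≡ sign e
conjμ-sign zero       = refl
conjμ-sign (suc zero) = refl

funToFin-cong : ∀ {m n} {f g : Fin m → Fin n} → (∀ i → f i ≡ g i) → funToFin f ≡ funToFin g
funToFin-cong {zero}  f≗g = refl
funToFin-cong {suc m} f≗g = cong₂ combine (f≗g zero) (funToFin-cong (f≗g ∘ suc))

finToFun-injective : ∀ {m n} {k l : Fin (m ^ n)} → (∀ i → finToFun k i ≡ finToFun l i) → k ≡ l
finToFun-injective {m} {n} {k} {l} k≗l = begin
  k                               ≡⟨ funToFin-finToFin {n} {m} k ⟨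
  funToFin (finToFun {m} {n} k)   ≡⟨ funToFin-cong {n} {m} k≗l ⟩
  funToFin (finToFun {m} {n} l)   ≡⟨ funToFin-finToFin {n} {m} l ⟩
  l                               ∎

signs : (s : ℕ) → Fin (2 ^ s) → Fin s → μ₄
signs s k = sign ∘ finToFun {2} {s} k

signVector : (s : ℕ) → Fin (2 ^ s) → Vector (s * s)
signVector s k = blockConst s (signs s k)

signs-injective : ∀ s {k l} → (∀ i → signs s k i ≡ signs s l i) → k ≡ l
signs-injective s {k} {l} k≗l =
  finToFun-injective {2} {s} (λ i → sign-injective {finToFun k i} {finToFun l i} (k≗l i))

signVector-injective : ∀ s {k l} → (∀ a → signVector s k a ≡ signVector s l a) → k ≡ l
signVector-injective s k≗l = signs-injective s (blockConst-injective s k≗l)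

conjμ-signVector : ∀ s k a → conjμ (signVector s k a) ≡ signVector s k a
conjμ-signVector s k a = conjμ-sign (finToFun k (quotient {s} s a))

atLeast-signVectors : ∀ s {P : Vector (s * s) → Set} → (∀ k → P (signVector s k)) → AtLeast (2 ^ s) P
atLeast-signVectors s P-sign = signVector s , P-sign , λ k l k≢l k≡l → k≢l (signVector-injective s k≡l)

proposition4p5 : (m : ℕ) → (H : Matrix ((2 * m) * (2 * m))) →
    IsBH ((2 * m) * (2 * m)) H → IsBushType (2 * m) H →
    AtLeast (2 ^ (2 * m)) (IsSelfDualBent (2 * m) H) ×
    AtLeast (2 ^ (2 * m)) (IsConjSelfDualBent (2 * m) (negM H))
proposition4p5 m H _ (rowSums , _) =
  atLeast-signVectors s {IsSelfDualBent s H} selfDual ,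
  atLeast-signVectors s {IsConjSelfDualBent s (negM H)} conjSelfDual
  where
  s : ℕ
  s = 2 * m
  selfDual : ∀ k → IsSelfDualBent s H (signVector s k)
  selfDual k = blockConst-selfDualBent s H (natG s) rowSums (normG-natG s) (signs s k)
  normG-−s : normG (-1G *G natG s) ≡ + (s * s)
  normG-−s = trans (normG-*G -1G (natG s)) (trans (ℤ.*-identityˡ _) (normG-natG s))
  conjSelfDual : ∀ k → IsConjSelfDualBent s (negM H) (signVector s k)
  conjSelfDual k = selfDualBent⇒conjSelfDualBent {r = s} {M = negM H} (conjμ-signVector s k)
    (blockConst-selfDualBent s (negM H) (-1G *G natG s)
      (negM-blockRowSums H (natG s) rowSums) normG-−s (signs s k))
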